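{- Let $(G,L_G)$ be a graft and let $x,y\in V(G)$ be adjacent vertices such that $x$ is a leaf (has degree one). Then \[ P^{\langle\tau\rangle}_{(G,L_G)}(z)=z\,P^{\langle\tau\rangle}_{(G\setminus\{x\},\,L_G\setminus\{x\})}(z)+2z^2\,P^{\langle\tau\rangle}_{(G\setminus\{x,y\},\,L_G\setminus\{x,y\})}(z). \]
   Context: A graft $(G,L_G)$ is a simple graph $G$ with a subset $L_G\subseteq V(G)$; its adjacency matrix $\mathbf A_{(G,L_G)}$ is the $V(G)\times V(G)$ matrix over $\mathrm{GF}(2)$ with $(u,v)$-entry $1$ iff ($u\ne v$ and $u,v$ adjacent) or ($u=v\in L_G$), and $0$ otherwise. The partial-$\langle\tau\rangle$ polynomial of the graft is $P^{\langle\tau\rangle}_{(G,L_G)}(z)=\sum_{A\subseteq V(G)} z^{\operatorname{rank}(\mathbf A_{(G,L_G\Delta A)})}$ (rank over $\mathrm{GF}(2)$, $\Delta$ the symmetric difference), and equals $1$ for the graft with no vertices. $G\setminus U$ denotes deletion of the vertex set $U$. -}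

module Defs where

open import Data.Nat using (ℕ; zero; suc; _+_; _*_)
open import Data.Bool using (Bool; true; false; _xor_; _∧_; if_then_else_)
open import Data.Fin using (Fin; zero; suc; punchIn; punchOut; _≟_)
open import Data.Fin.Subset using (Subset)
open import Data.Vec using (Vec; []; _∷_; lookup; zipWith; tabulate)
open import Data.List using (List; []; _∷_; map; _++_; foldr; length; filter; allFin)
open import Relation.Binary.PropositionalEquality using (_≡_; _≢_; refl; sym; trans)
open import Relation.Nullary using (yes; no; does)
open import Data.Empty using (⊥)

Row : ℕ → Set
Row n = Fin n → Bool

Matrix : ℕ → Set
Matrix n = Fin n → Fin n → Bool

subsets : (n : ℕ) → List (Subset n)
subsets zero    = [] ∷ []
subsets (suc n) = map (false ∷_) (subsets n) ++ map (true ∷_) (subsets n)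

card : ∀ {n} → Subset n → ℕ
card []           = 0
card (false ∷ s)  = card s
card (true  ∷ s)  = suc (card s)

_⊆ᵇ_ : ∀ {n} → Subset n → Subset n → Bool
[]          ⊆ᵇ []          = true
(true ∷ t)  ⊆ᵇ (false ∷ s) = false
(_ ∷ t)     ⊆ᵇ (_ ∷ s)     = t ⊆ᵇ s

allᵇ : {A : Set} → (A → Bool) → List A → Bool
allᵇ p = foldr (λ a acc → p a ∧ acc) true

isZeroRow : ∀ {n} → Row n → Bool
isZeroRow {n} r = allᵇ (λ j → if r j then false else true) (allFin n)

rowSum : ∀ {n} → Matrix n → Subset n → Row n
rowSum {n} M T j = foldr (λ i acc → (lookup T i ∧ M i j) xor acc) false (allFin n)

independentᵇ : ∀ {n} → Matrix n → Subset n → Bool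
independentᵇ {n} M S =
  allᵇ (λ T → if T ⊆ᵇ S then (if card T Data.Nat.≡ᵇ 0 then true
                              else (if isZeroRow (rowSum M T) then false else true))
             else true)
      (subsets n)

maxℕ : ℕ → ℕ → ℕ
maxℕ = Data.Nat._⊔_

rank : ∀ {n} → Matrix n → ℕ
rank {n} M = foldr (λ S acc → if independentᵇ M S then maxℕ (card S) acc else acc)
                   0 (subsets n)

record Graft (n : ℕ) : Set where
  field
    adj     : Fin n → Fin n → Bool
    adj-sym : ∀ u v → adj u v ≡ adj v u
    adj-irr : ∀ u → adj u u ≡ false
    L       : Subset n
open Graft public

adjMatrix : ∀ {n} → Graft n → Subset n → Matrix n
adjMatrix G L' u v = if does (u ≟ v) then lookup L' u else adj G u v

_Δ_ : ∀ {n} → Subset n → Subset n → Subset n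
_Δ_ = zipWith _xor_

Poly : Set
Poly = ℕ → ℕ

zMul : Poly → Poly
zMul p zero    = 0
zMul p (suc k) = p k

scale : ℕ → Poly → Poly
scale c p k = c * p k

_⊕_ : Poly → Poly → Poly
(p ⊕ q) k = p k + q k

_≈P_ : Poly → Poly → Set
p ≈P q = ∀ k → p k ≡ q k

partialTau : ∀ {n} → Graft n → Poly
partialTau {n} G k =
  length (filter (λ A → k Data.Nat.≟ rank (adjMatrix G (L G Δ A))) (subsets n))

deleteVertex : ∀ {n} → Graft (suc n) → Fin (suc n) → Graft n
deleteVertex G x = record
  { adj     = λ u v → adj G (punchIn x u) (punchIn x v)
  ; adj-sym = λ u v → adj-sym G (punchIn x u) (punchIn x v)
  ; adj-irr = λ u → adj-irr G (punchIn x u)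
  ; L       = tabulate (λ u → lookup (L G) (punchIn x u))
  }

degree : ∀ {n} → Graft n → Fin n → ℕ
degree {n} G x = length (filter (λ v → adj G x v Data.Bool.≟ true) (allFin n))

adj⇒≢ : ∀ {n} (G : Graft n) {x y : Fin n} → adj G x y ≡ true → x ≢ y
adj⇒≢ G {x} e refl with trans (sym e) (adj-irr G x)
... | ()

deleteTwo : ∀ {n} (G : Graft (suc (suc n))) (x y : Fin (suc (suc n))) →
            x ≢ y → Graft n
deleteTwo G x y x≢y = deleteVertex (deleteVertex G x) (punchOut x≢y)

-- Split the sum over A ⊆ V(G) according to whether the leaf x carries a loop in
-- L_G Δ A.  Over GF(2) a pivot entry M i c = 1 can be eliminated at the cost of
-- exactly one unit of rank.  If x has a loop, eliminating at (x, x) leaves the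
-- adjacency matrix of G \ x with the loop at y toggled, and toggling is a bijection
-- on the subsets A, which gives z P(G \ x).  If x has no loop, its row is the unit
-- vector at y, so eliminating at (x, y) and then at (y, x) removes both vertices
-- whatever the loop at y is; the two choices for that loop give 2 z² P(G \ {x, y}).
-- Since rank is defined as the largest size of an independent set of rows, the
-- elimination step is proved by moving independent sets between the two matrices.

module Submission where

open import Defs
open import Algebra.Bundles using (CommutativeRing)
import Algebra.Properties.CommutativeMonoid.Sum as MonoidSum
import Algebra.Properties.Semiring.Sum as SemiringSum
open import Data.Bool using (Bool; true; false; _xor_; _∧_; if_then_else_)
open import Data.Bool.Properties as Bool
  using ( xor-∧-commutativeRing; xor-same; xor-comm; xor-identityʳ; ∧-idem; ∧-distribʳ-xor
        ; ∧-zeroʳ; ∧-identityʳ; ∧-conicalˡ; ∧-conicalʳ)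
open import Data.Empty using (⊥-elim)
open import Data.Fin using (Fin; zero; suc; punchIn; punchOut; _≟_)
open import Data.Fin.Properties using (punchIn-punchOut; punchIn-injective; punchInᵢ≢i; all?)
open import Data.Fin.Subset using (Subset; ⁅_⁆)
open import Data.Fin.Subset.Properties using (anySubset?)
open import Data.List using (List; []; _∷_; _++_; foldr; allFin; length; filter)
import Data.List as List
open import Data.List.Membership.Propositional using (_∈_)
open import Data.List.Membership.Propositional.Properties
  using (∈-allFin; ∈-++⁺ˡ; ∈-++⁺ʳ; ∈-map⁺)
open import Data.List.Relation.Unary.Any as Any using (here; there)
open import Data.List.Properties using (filter-≐; filter-++; length-++; filter-accept; filter-some)
open import Data.Nat using (ℕ; zero; suc; _+_; _*_; _≤_; z≤n; s≤s; _⊔_; _≡ᵇ_)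
import Data.Nat as ℕ
open import Data.Nat.Properties
  using ( +-0-commutativeMonoid; +-commutativeSemigroup; +-monoˡ-≤; +-comm; +-identityʳ
        ; ≤-refl; ≤-reflexive; ≤-trans; ≤-antisym; m≤n⇒m≤1+n; m≤m⊔n; m≤n⊔m; ⊔-sel)
open import Algebra.Properties.CommutativeSemigroup +-commutativeSemigroup using (interchange)
open import Data.Product using (∃-syntax; _×_; _,_)
open import Data.Sum using (_⊎_; inj₁; inj₂)
open import Data.Vec using ([]; _∷_; lookup; tabulate; insertAt)
open import Data.Vec.Properties
  using (lookup∘tabulate; lookup-zipWith; lookup-replicate; insertAt-lookup; insertAt-punchIn)
open import Data.Vec.Functional using (removeAt)
import Data.Vec.Functional as VF
import Data.Vec.Functional.Properties as VF
open import Function using (_∘_; const)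
open import Relation.Binary.PropositionalEquality
open import Relation.Nullary using (Dec; yes; no; does; ¬_; contradiction)
open import Relation.Nullary.Decidable using (dec-false; map′; _×-dec_; _→-dec_)

module GF2 = SemiringSum (CommutativeRing.semiring xor-∧-commutativeRing)
module ℕΣ = MonoidSum +-0-commutativeMonoid

punchIn-cases : ∀ {n} {P : Fin (suc n) → Set} (i : Fin (suc n)) →
                P i → (∀ u → P (punchIn i u)) → ∀ k → P k
punchIn-cases {P = P} i Pi Pu k with k ≟ i
... | yes refl = Pi
... | no k≢i   = subst P (punchIn-punchOut (k≢i ∘ sym)) (Pu (punchOut (k≢i ∘ sym)))

_⊆_ : ∀ {m} → (Fin m → Bool) → (Fin m → Bool) → Set
t ⊆ s = ∀ i → t i ≡ true → s i ≡ true

insertAt-⊆ : ∀ {m} {s : Fin (suc m) → Bool} {t : Fin m → Bool} (i : Fin (suc m)) {b} →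
             (b ≡ true → s i ≡ true) → t ⊆ removeAt s i → VF.insertAt t i b ⊆ s
insertAt-⊆ {s = s} {t} i {b} b⇒sᵢ t⊆ =
  punchIn-cases {P = λ k → VF.insertAt t i b k ≡ true → s k ≡ true} i
  (λ eq → b⇒sᵢ (trans (sym (VF.insertAt-lookup t i b)) eq))
  (λ u eq → t⊆ u (trans (sym (VF.insertAt-punchIn t i b u)) eq))

bit : Bool → ℕ
bit b = if b then 1 else 0

size : ∀ {m} → (Fin m → Bool) → ℕ
size s = ℕΣ.sum (bit ∘ s)

size-cong : ∀ {m} {s r : Fin m → Bool} → s ≗ r → size s ≡ size r
size-cong s≗r = ℕΣ.sum-cong-≗ (cong bit ∘ s≗r)

size-remove : ∀ {m} (s : Fin (suc m) → Bool) i → size s ≡ bit (s i) + size (removeAt s i)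
size-remove s i = ℕΣ.sum-remove {i = i} (bit ∘ s)

size-insertAt : ∀ {m} (t : Fin m → Bool) i b → size (VF.insertAt t i b) ≡ bit b + size t
size-insertAt t i b = trans (size-remove (VF.insertAt t i b) i)
  (cong₂ (λ c r → bit c + r) (VF.insertAt-lookup t i b) (size-cong (VF.insertAt-punchIn t i b)))

size-removeAt : ∀ {m} (s : Fin (suc m) → Bool) i → size s ≤ suc (size (removeAt s i))
size-removeAt s i = ≤-trans (≤-reflexive (size-remove s i)) (+-monoˡ-≤ _ (bit≤1 (s i)))
  where
  bit≤1 : ∀ b → bit b ≤ 1
  bit≤1 false = z≤n
  bit≤1 true  = ≤-refl

erase : ∀ {m} → (Fin m → Bool) → Fin m → (Fin m → Bool)
erase {suc m} r v = VF.insertAt (removeAt r v) v false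

erase-⊆ : ∀ {m} (r : Fin m → Bool) v → erase r v ⊆ r
erase-⊆ {suc m} r v = insertAt-⊆ v (λ ()) (λ _ eq → eq)

erase-removes : ∀ {m} (r : Fin m → Bool) v → erase r v v ≡ false
erase-removes {suc m} r v = VF.insertAt-lookup (removeAt r v) v false

size-erase : ∀ {m} (r : Fin m → Bool) {v} → r v ≡ true → size r ≡ suc (size (erase r v))
size-erase {suc m} r {v} rᵥ = begin
  size r                       ≡⟨ size-remove r v ⟩
  bit (r v) + size (removeAt r v) ≡⟨ cong (λ b → bit b + size (removeAt r v)) rᵥ ⟩
  suc (size (removeAt r v))    ≡⟨ cong suc (sym (size-insertAt (removeAt r v) v false)) ⟩
  suc (size (erase r v))       ∎
  where open ≡-Reasoning

card≡size : ∀ {m} (T : Subset m) → card T ≡ size (lookup T)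
card≡size []          = refl
card≡size (false ∷ T) = card≡size T
card≡size (true ∷ T)  = cong suc (card≡size T)

sum-false : ∀ {m} {g : Fin m → Bool} → g ≗ const false → GF2.sum g ≡ false
sum-false {m} g≗0 = trans (GF2.sum-cong-≗ g≗0) (GF2.sum-replicate-zero m)

sum≡true⇒nonzero : ∀ {m} (g : Fin m → Bool) → GF2.sum g ≡ true → ∃[ k ] g k ≡ true
sum≡true⇒nonzero {suc m} g Σg with g zero in g₀
... | true  = zero , g₀
... | false with sum≡true⇒nonzero (g ∘ suc) Σg
...   | k , gk = suc k , gk

foldr-xor-tabulate : ∀ {m k} (f : Fin m → Fin k) (g : Fin k → Bool) →
                     foldr (λ i acc → g i xor acc) false (List.tabulate f) ≡ GF2.sum (g ∘ f)
foldr-xor-tabulate {zero}  f g = refl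
foldr-xor-tabulate {suc m} f g = cong (g (f zero) xor_) (foldr-xor-tabulate (f ∘ suc) g)

combination : ∀ {m n} → (Fin m → Row n) → (Fin m → Bool) → Row n
combination M t j = GF2.sum (λ i → t i ∧ M i j)

rowSum≡combination : ∀ {n} (M : Matrix n) (T : Subset n) → rowSum M T ≗ combination M (lookup T)
rowSum≡combination M T j = foldr-xor-tabulate (λ i → i) (λ i → lookup T i ∧ M i j)

module _ {m n} (M : Fin m → Row n) where

  combination-cong : ∀ {t u} → t ≗ u → combination M t ≗ combination M u
  combination-cong t≗u j = GF2.sum-cong-≗ (λ i → cong (_∧ M i j) (t≗u i))

  combination-xor : ∀ t u j →
                    combination M (λ i → t i xor u i) j ≡ combination M t j xor combination M u j
  combination-xor t u j = trans (GF2.sum-cong-≗ (λ i → ∧-distribʳ-xor (M i j) (t i) (u i)))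
                                (GF2.∑-distrib-+ (λ i → t i ∧ M i j) (λ i → u i ∧ M i j))

  combination-nonzero : ∀ t j → combination M t j ≡ true → ∃[ i ] t i ≡ true
  combination-nonzero t j eq with sum≡true⇒nonzero _ eq
  ... | i , tᵢ∧Mᵢⱼ = i , ∧-conicalˡ (t i) _ tᵢ∧Mᵢⱼ

combination-remove : ∀ {m n} (M : Fin (suc m) → Row n) t i j →
  combination M t j ≡ (t i ∧ M i j) xor combination (removeAt M i) (removeAt t i) j
combination-remove M t i j = GF2.sum-remove {i = i} (λ k → t k ∧ M k j)

combination-insertAt : ∀ {m n} (M : Fin (suc m) → Row n) t i b j →
  combination M (VF.insertAt t i b) j ≡ (b ∧ M i j) xor combination (removeAt M i) t j
combination-insertAt M t i b j =
  trans (combination-remove M (VF.insertAt t i b) i j)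
        (cong₂ (λ a r → (a ∧ M i j) xor r) (VF.insertAt-lookup t i b)
               (combination-cong (removeAt M i) (VF.insertAt-punchIn t i b) j))

Independent : ∀ {m n} → (Fin m → Row n) → (Fin m → Bool) → Set
Independent M s = ∀ t → t ⊆ s → combination M t ≗ const false → t ≗ const false

Independent-cong : ∀ {m n} {M N : Fin m → Row n} {s r : Fin m → Bool} →
                   (∀ i j → M i j ≡ N i j) → s ≗ r → Independent M s → Independent N r
Independent-cong M≗N s≗r ind t t⊆r Nt≗0 =
  ind t (λ i tᵢ → trans (s≗r i) (t⊆r i tᵢ))
        (λ j → trans (GF2.sum-cong-≗ (λ i → cong (t i ∧_) (M≗N i j))) (Nt≗0 j))

xor≡false⇒≡ : ∀ {a b} → a xor b ≡ false → a ≡ b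
xor≡false⇒≡ {false} {false} _ = refl
xor≡false⇒≡ {true}  {true}  _ = refl

module _ {m n} {M : Fin m → Row n} {s : Fin m → Bool} (ind : Independent M s) where

  combination-injective : ∀ {t u} → t ⊆ s → u ⊆ s → combination M t ≗ combination M u → t ≗ u
  combination-injective {t} {u} t⊆s u⊆s Mt≗Mu i =
    xor≡false⇒≡ (ind (λ k → t k xor u k) t⊕u⊆s
                    (λ j → trans (combination-xor M t u j)
                                 (trans (cong (_xor Mu j) (Mt≗Mu j)) (xor-same (Mu j))))
                    i)
    where
    Mu = combination M u
    t⊕u⊆s : (λ k → t k xor u k) ⊆ s
    t⊕u⊆s k with t k in tₖ
    ... | true  = λ _ → t⊆s k tₖ
    ... | false = u⊆s k

Independent-removeAt : ∀ {m n} {M : Fin (suc m) → Row n} {s} (i : Fin (suc m)) →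
                       Independent M s → Independent (removeAt M i) (removeAt s i)
Independent-removeAt {M = M} i ind t t⊆ Mt≗0 u =
  trans (sym (VF.insertAt-punchIn t i false u))
        (ind t′ (insertAt-⊆ i (λ ()) t⊆) M-t′≗0 (punchIn i u))
  where
  t′ = VF.insertAt t i false
  M-t′≗0 : combination M t′ ≗ const false
  M-t′≗0 j = trans (combination-insertAt M t i false j) (Mt≗0 j)

empty-independent : ∀ {m n} (M : Fin m → Row n) → Independent M (const false)
empty-independent M t t⊆∅ _ i with t i in tᵢ
... | false = refl
... | true with t⊆∅ i tᵢ
...   | ()

-- rank M unfolds to maxOver (independentᵇ M) card (subsets n).
module _ {A : Set} (p : A → Bool) (c : A → ℕ) where

  maxOver : List A → ℕ
  maxOver = foldr (λ a acc → if p a then c a ⊔ acc else acc) 0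

  maxOver-upper : ∀ {a xs} → a ∈ xs → p a ≡ true → c a ≤ maxOver xs
  maxOver-upper {xs = a ∷ xs} (here refl) pa rewrite pa = m≤m⊔n (c a) _
  maxOver-upper {xs = b ∷ xs} (there a∈) pa with p b
  ... | true  = ≤-trans (maxOver-upper a∈ pa) (m≤n⊔m (c b) _)
  ... | false = maxOver-upper a∈ pa

  maxOver-attained : ∀ {d} xs → p d ≡ true → ∃[ a ] p a ≡ true × maxOver xs ≤ c a
  maxOver-attained {d} []       pd = d , pd , z≤n
  maxOver-attained     (b ∷ xs) pd with p b in pb | maxOver-attained xs pd
  ... | false | rest = rest
  ... | true  | a , pa , le with ⊔-sel (c b) (maxOver xs)
  ...   | inj₁ eq = b , pb , ≤-reflexive eq
  ...   | inj₂ eq = a , pa , ≤-trans (≤-reflexive eq) le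

allᵇ-intro : ∀ {A : Set} (p : A → Bool) xs →
             (∀ {a} → a ∈ xs → p a ≡ true) → allᵇ p xs ≡ true
allᵇ-intro p []       _ = refl
allᵇ-intro p (a ∷ xs) h rewrite h (here refl) = allᵇ-intro p xs (h ∘ there)

allᵇ-elim : ∀ {A : Set} (p : A → Bool) {xs a} → allᵇ p xs ≡ true → a ∈ xs → p a ≡ true
allᵇ-elim p {a ∷ xs} eq (here refl) = ∧-conicalˡ (p a) _ eq
allᵇ-elim p {a ∷ xs} eq (there a∈)  = allᵇ-elim p (∧-conicalʳ (p a) _ eq) a∈

∈-subsets : ∀ {m} (T : Subset m) → T ∈ subsets m
∈-subsets []                = here refl
∈-subsets {suc m} (false ∷ T) = ∈-++⁺ˡ (∈-map⁺ (false ∷_) (∈-subsets T))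
∈-subsets {suc m} (true ∷ T)  =
  ∈-++⁺ʳ (List.map (false ∷_) (subsets m)) (∈-map⁺ (true ∷_) (∈-subsets T))

isZeroRow-intro : ∀ {n} (r : Row n) → r ≗ const false → isZeroRow r ≡ true
isZeroRow-intro {n} r r≗0 =
  allᵇ-intro _ (allFin n) (λ {j} _ → cong (λ b → if b then false else true) (r≗0 j))

isZeroRow-elim : ∀ {n} (r : Row n) → isZeroRow r ≡ true → r ≗ const false
isZeroRow-elim r eq j with r j | allᵇ-elim (λ j → if r j then false else true) eq (∈-allFin j)
... | false | _ = refl

⊆ᵇ-intro : ∀ {m} (T S : Subset m) → lookup T ⊆ lookup S → T ⊆ᵇ S ≡ true
⊆ᵇ-intro []          []          _   = refl
⊆ᵇ-intro (true ∷ T)  (true ∷ S)  T⊆S = ⊆ᵇ-intro T S (T⊆S ∘ suc)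
⊆ᵇ-intro (false ∷ T) (true ∷ S)  T⊆S = ⊆ᵇ-intro T S (T⊆S ∘ suc)
⊆ᵇ-intro (false ∷ T) (false ∷ S) T⊆S = ⊆ᵇ-intro T S (T⊆S ∘ suc)
⊆ᵇ-intro (true ∷ T)  (false ∷ S) T⊆S with T⊆S zero refl
... | ()

⊆ᵇ-elim : ∀ {m} (T S : Subset m) → T ⊆ᵇ S ≡ true → lookup T ⊆ lookup S
⊆ᵇ-elim (true ∷ T)  (true ∷ S)  _  zero    _ = refl
⊆ᵇ-elim (true ∷ T)  (true ∷ S)  eq (suc i)   = ⊆ᵇ-elim T S eq i
⊆ᵇ-elim (false ∷ T) (true ∷ S)  eq (suc i)   = ⊆ᵇ-elim T S eq i
⊆ᵇ-elim (false ∷ T) (false ∷ S) eq (suc i)   = ⊆ᵇ-elim T S eq i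

card≡ᵇ0⇒empty : ∀ {m} (T : Subset m) → (card T ≡ᵇ 0) ≡ true → lookup T ≗ const false
card≡ᵇ0⇒empty (false ∷ T) _  zero    = refl
card≡ᵇ0⇒empty (false ∷ T) eq (suc i) = card≡ᵇ0⇒empty T eq i

-- The test that independentᵇ performs on each T is the boolean implication
-- (T ⊆ S) ⇒ (rows of T sum to zero) ⇒ (T is empty).
implicationᵇ-intro : ∀ a b c → (a ≡ true → c ≡ true → b ≡ true) →
                     (if a then (if b then true else (if c then false else true)) else true) ≡ true
implicationᵇ-intro false b     c     _ = refl
implicationᵇ-intro true  true  c     _ = refl
implicationᵇ-intro true  false false _ = refl
implicationᵇ-intro true  false true  h with h refl refl
... | ()

implicationᵇ-elim : ∀ a b c →
                    (if a then (if b then true else (if c then false else true)) else true) ≡ true →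
                    a ≡ true → c ≡ true → b ≡ true
implicationᵇ-elim true true  c     _  _ _ = refl
implicationᵇ-elim true false true  () _ _
implicationᵇ-elim true false false _  _ ()

module _ {n} (M : Matrix n) where

  independentᵇ-sound : ∀ S → independentᵇ M S ≡ true → Independent M (lookup S)
  independentᵇ-sound S eq t t⊆S Mt≗0 i =
    trans (sym (lookup∘tabulate t i)) (card≡ᵇ0⇒empty T T-empty i)
    where
    T = tabulate t
    T≗t = lookup∘tabulate t
    T-empty : (card T ≡ᵇ 0) ≡ true
    T-empty = implicationᵇ-elim _ _ _ (allᵇ-elim _ eq (∈-subsets T))
      (⊆ᵇ-intro T S (λ k Tₖ → t⊆S k (trans (sym (T≗t k)) Tₖ)))
      (isZeroRow-intro _ (λ j → trans (rowSum≡combination M T j)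
                                      (trans (combination-cong M T≗t j) (Mt≗0 j))))

  independentᵇ-complete : ∀ S → Independent M (lookup S) → independentᵇ M S ≡ true
  independentᵇ-complete S ind = allᵇ-intro _ (subsets n) λ {T} _ →
    implicationᵇ-intro _ _ _ λ T⊆S T-null →
      let T≗∅ = ind (lookup T) (⊆ᵇ-elim T S T⊆S)
                    (λ j → trans (sym (rowSum≡combination M T j)) (isZeroRow-elim _ T-null j))
      in subst (λ k → (k ≡ᵇ 0) ≡ true)
               (sym (trans (card≡size T) (trans (size-cong T≗∅) (ℕΣ.sum-replicate-zero n))))
               refl

  size≤rank : ∀ {s} → Independent M s → size s ≤ rank M
  size≤rank {s} ind =
    subst (_≤ rank M) (trans (card≡size S) (size-cong (lookup∘tabulate s)))
      (maxOver-upper (independentᵇ M) card (∈-subsets S)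
         (independentᵇ-complete S
            (Independent-cong (λ _ _ → refl) (sym ∘ lookup∘tabulate s) ind)))
    where S = tabulate s

  rank-attained : ∃[ s ] Independent M s × rank M ≤ size s
  rank-attained with maxOver-attained (independentᵇ M) card (subsets n) ∅-independent
    where
    ∅ = tabulate {n = n} (const false)
    ∅-independent = independentᵇ-complete ∅
      (Independent-cong (λ _ _ → refl) (sym ∘ lookup∘tabulate (const false)) (empty-independent M))
  ... | S , indS , le =
    lookup S , independentᵇ-sound S indS , ≤-trans le (≤-reflexive (card≡size S))

rank-cong : ∀ {n} {M N : Matrix n} → (∀ i j → M i j ≡ N i j) → rank M ≡ rank N
rank-cong {M = M} {N} M≗N with rank-attained M | rank-attained N
... | s , indₛ , M≤s | r , indᵣ , N≤r =
  ≤-antisym (≤-trans M≤s (size≤rank N (Independent-cong M≗N (λ _ → refl) indₛ)))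
            (≤-trans N≤r (size≤rank M (Independent-cong N≗M (λ _ → refl) indᵣ)))
  where
  N≗M : ∀ i j → N i j ≡ M i j
  N≗M i j = sym (M≗N i j)

rank≡suc : ∀ {m n} (M : Matrix m) (N : Matrix n) →
  (∀ r → Independent N r → ∃[ s ] Independent M s × suc (size r) ≤ size s) →
  (∀ s → Independent M s → ∃[ r ] Independent N r × size s ≤ suc (size r)) →
  rank M ≡ suc (rank N)
rank≡suc M N lift descend with rank-attained M | rank-attained N
... | s , indₛ , M≤s | r , indᵣ , N≤r with descend s indₛ | lift r indᵣ
...   | r′ , indᵣ′ , s≤r′ | s′ , indₛ′ , r<s′ =
  ≤-antisym (≤-trans M≤s (≤-trans s≤r′ (s≤s (size≤rank N indᵣ′))))
            (≤-trans (s≤s N≤r) (≤-trans r<s′ (size≤rank M indₛ′)))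

minor : ∀ {n} → Matrix (suc n) → Fin (suc n) → Fin (suc n) → Matrix n
minor M i c u j = M (punchIn i u) (punchIn c j)

eliminate : ∀ {n} → Matrix (suc n) → Fin (suc n) → Fin (suc n) → Matrix n
eliminate M i c u j = minor M i c u j xor (M (punchIn i u) c ∧ M i (punchIn c j))

module Elimination {n} (M : Matrix (suc n)) (i c : Fin (suc n)) (Mᵢc : M i c ≡ true) where

  reduce : Row (suc n) → Row n
  reduce w j = w (punchIn c j) xor (w c ∧ M i (punchIn c j))

  reduce-cong : ∀ {w w′} → w ≗ w′ → reduce w ≗ reduce w′
  reduce-cong w≗w′ j =
    cong₂ (λ a b → a xor (b ∧ M i (punchIn c j))) (w≗w′ (punchIn c j)) (w≗w′ c)

  reduce-multiple : ∀ b → reduce (λ k → b ∧ M i k) ≗ const false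
  reduce-multiple false j = refl
  reduce-multiple true  j rewrite Mᵢc = xor-same (M i (punchIn c j))

  reduce-kernel : ∀ w → reduce w ≗ const false → w ≗ const false ⊎ w ≗ M i
  reduce-kernel w w↦0 with w c in w꜀
  ... | false = inj₁ (punchIn-cases {P = λ k → w k ≡ false} c w꜀
                       (λ j → trans (sym (xor-identityʳ _)) (w↦0 j)))
  ... | true  = inj₂ (punchIn-cases {P = λ k → w k ≡ M i k} c (trans w꜀ (sym Mᵢc))
                       (λ j → xor≡false⇒≡ (w↦0 j)))

  combination-eliminate : ∀ t →
    combination (eliminate M i c) t ≗ reduce (combination (removeAt M i) t)
  combination-eliminate t j = begin
    GF2.sum (λ u → t u ∧ (minor M i c u j xor (M (punchIn i u) c ∧ p)))
      ≡⟨ GF2.sum-cong-≗ (λ u → distrib (t u) (minor M i c u j) (M (punchIn i u) c)) ⟩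
    GF2.sum (λ u → (t u ∧ minor M i c u j) xor ((t u ∧ M (punchIn i u) c) ∧ p))
      ≡⟨ GF2.∑-distrib-+ (λ u → t u ∧ minor M i c u j) (λ u → (t u ∧ M (punchIn i u) c) ∧ p) ⟩
    combination (removeAt M i) t (punchIn c j) xor GF2.sum (λ u → (t u ∧ M (punchIn i u) c) ∧ p)
      ≡⟨ cong (combination (removeAt M i) t (punchIn c j) xor_)
              (sym (GF2.*-distribʳ-sum p (λ u → t u ∧ M (punchIn i u) c))) ⟩
    reduce (combination (removeAt M i) t) j ∎
    where
    open ≡-Reasoning
    p = M i (punchIn c j)
    distrib : ∀ a b d → a ∧ (b xor (d ∧ p)) ≡ (a ∧ b) xor ((a ∧ d) ∧ p)
    distrib false b d = refl
    distrib true  b d = refl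

  dependency-removeAt : ∀ t → combination M t ≗ const false →
                        combination (removeAt M i) (removeAt t i) ≗ (λ j → t i ∧ M i j)
  dependency-removeAt t Mt≗0 j =
    sym (xor≡false⇒≡ (trans (sym (combination-remove M t i j)) (Mt≗0 j)))

  independent-insert-pivot : ∀ {r} → Independent (eliminate M i c) r →
                             Independent M (VF.insertAt r i true)
  independent-insert-pivot {r} ind t t⊆ Mt≗0 =
    punchIn-cases {P = λ k → t k ≡ false} i tᵢ≡false t′≗0
    where
    t′ = removeAt t i
    rest≗ = dependency-removeAt t Mt≗0
    t′≗0 : t′ ≗ const false
    t′≗0 = ind t′ (λ u tᵤ → trans (sym (VF.insertAt-punchIn r i true u)) (t⊆ (punchIn i u) tᵤ))
                  (λ j → trans (combination-eliminate t′ j)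
                               (trans (reduce-cong rest≗ j) (reduce-multiple (t i) j)))
    tᵢ≡false : t i ≡ false
    tᵢ≡false = begin
      t i                             ≡⟨ sym (∧-identityʳ (t i)) ⟩
      t i ∧ true                      ≡⟨ cong (t i ∧_) (sym Mᵢc) ⟩
      t i ∧ M i c                     ≡⟨ sym (rest≗ c) ⟩
      combination (removeAt M i) t′ c ≡⟨ sum-false (λ u → cong (_∧ M (punchIn i u) c) (t′≗0 u)) ⟩
      false                           ∎
      where open ≡-Reasoning

  SumsToPivotRow : (Fin n → Bool) → Set
  SumsToPivotRow u = combination (removeAt M i) u ≗ M i

  PivotRowSpannedBy : (Fin n → Bool) → Set
  PivotRowSpannedBy r = ∃[ u ] u ⊆ r × SumsToPivotRow u

  pivotRowSpannedBy? : ∀ r → Dec (PivotRowSpannedBy r)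
  pivotRowSpannedBy? r = map′ (λ (T , T⊆r , T-spans) → lookup T , T⊆r , T-spans) from
    (anySubset? λ T → all? (λ k → (lookup T k Bool.≟ true) →-dec (r k Bool.≟ true))
                  ×-dec all? (λ j → combination (removeAt M i) (lookup T) j Bool.≟ M i j))
    where
    from : PivotRowSpannedBy r → ∃[ T ] lookup T ⊆ r × SumsToPivotRow (lookup T)
    from (u , u⊆r , u-spans) =
      tabulate u , (λ k eq → u⊆r k (trans (sym (lookup∘tabulate u k)) eq))
                 , (λ j → trans (combination-cong (removeAt M i) (lookup∘tabulate u) j) (u-spans j))

  eliminate-dependency : ∀ {r t} → Independent (removeAt M i) r → t ⊆ r →
                         combination (eliminate M i c) t ≗ const false →
                         t ≗ const false ⊎ SumsToPivotRow t
  eliminate-dependency {t = t} ind t⊆r dep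
    with reduce-kernel _ (λ j → trans (sym (combination-eliminate t j)) (dep j))
  ... | inj₁ rest≗0  = inj₁ (ind t t⊆r rest≗0)
  ... | inj₂ t-spans = inj₂ t-spans

  independent-unless-spanned : ∀ {r} → Independent (removeAt M i) r → ¬ PivotRowSpannedBy r →
                               Independent (eliminate M i c) r
  independent-unless-spanned ind unspanned t t⊆r dep with eliminate-dependency ind t⊆r dep
  ... | inj₁ t≗0     = t≗0
  ... | inj₂ t-spans = ⊥-elim (unspanned (t , t⊆r , t-spans))

  -- Row i has at most one representation by rows of r, so none survives erasing a row of u.
  independent-erase : ∀ {r u v} → Independent (removeAt M i) r →
                      u ⊆ r → SumsToPivotRow u → u v ≡ true →
                      Independent (eliminate M i c) (erase r v)
  independent-erase {r} {v = v} ind u⊆r u-spans uᵥ t t⊆ dep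
    with eliminate-dependency ind (λ k → erase-⊆ r v k ∘ t⊆ k) dep
  ... | inj₁ t≗0     = t≗0
  ... | inj₂ t-spans with trans (sym (erase-removes r v)) (t⊆ v (trans (t≗u v) uᵥ))
    where
    t≗u = combination-injective ind (λ k → erase-⊆ r v k ∘ t⊆ k) u⊆r
                                (λ j → trans (t-spans j) (sym (u-spans j)))
  ...   | ()

  spanned⇒pivot-excluded : ∀ {s} → Independent M s →
                           PivotRowSpannedBy (removeAt s i) → s i ≡ false
  spanned⇒pivot-excluded {s} ind (u , u⊆ , u-spans) with s i in sᵢ
  ... | false = refl
  ... | true with ind (VF.insertAt u i true) (insertAt-⊆ i (λ _ → sᵢ) u⊆) dep i
    where
    dep : combination M (VF.insertAt u i true) ≗ const false
    dep j = trans (combination-insertAt M u i true j)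
                  (trans (cong (M i j xor_) (u-spans j)) (xor-same (M i j)))
  ...   | insertedᵢ≡false with trans (sym (VF.insertAt-lookup u i true)) insertedᵢ≡false
  ...     | ()

  -- If row i is not spanned by the other rows of s, those rows stay independent after
  -- elimination; otherwise i ∉ s, and dropping one row of the spanning set suffices.
  descend : ∀ s → Independent M s →
            ∃[ r ] Independent (eliminate M i c) r × size s ≤ suc (size r)
  descend s ind with pivotRowSpannedBy? (removeAt s i)
  ... | no unspanned = removeAt s i
                     , independent-unless-spanned (Independent-removeAt {M = M} i ind) unspanned
                     , size-removeAt s i
  ... | yes spanned@(u , u⊆ , u-spans)
    with combination-nonzero (removeAt M i) u c (trans (u-spans c) Mᵢc)
  ...   | v , uᵥ = erase (removeAt s i) v
                 , independent-erase (Independent-removeAt {M = M} i ind) u⊆ u-spans uᵥ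
                 , ≤-reflexive size-eq
    where
    size-eq : size s ≡ suc (size (erase (removeAt s i) v))
    size-eq = trans (size-remove s i)
                (trans (cong (λ b → bit b + size (removeAt s i)) (spanned⇒pivot-excluded ind spanned))
                       (size-erase (removeAt s i) (u⊆ v uᵥ)))

rank-eliminate : ∀ {n} (M : Matrix (suc n)) i c → M i c ≡ true →
                 rank M ≡ suc (rank (eliminate M i c))
rank-eliminate M i c Mᵢc = rank≡suc M (eliminate M i c)
  (λ r ind → VF.insertAt r i true , independent-insert-pivot ind
                                    , ≤-reflexive (sym (size-insertAt r i true)))
  descend
  where open Elimination M i c Mᵢc

rank-minor-row : ∀ {n} (M : Matrix (suc n)) i c → M i c ≡ true →
                 (∀ j → M i (punchIn c j) ≡ false) → rank M ≡ suc (rank (minor M i c))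
rank-minor-row M i c Mᵢc row = trans (rank-eliminate M i c Mᵢc) (cong suc (rank-cong entries))
  where
  entries : ∀ u j → eliminate M i c u j ≡ minor M i c u j
  entries u j rewrite row j | ∧-zeroʳ (M (punchIn i u) c) = xor-identityʳ (minor M i c u j)

rank-minor-column : ∀ {n} (M : Matrix (suc n)) i c → M i c ≡ true →
                    (∀ u → M (punchIn i u) c ≡ false) → rank M ≡ suc (rank (minor M i c))
rank-minor-column M i c Mᵢc column = trans (rank-eliminate M i c Mᵢc) (cong suc (rank-cong entries))
  where
  entries : ∀ u j → eliminate M i c u j ≡ minor M i c u j
  entries u j rewrite column u = xor-identityʳ (minor M i c u j)

count : {A : Set} → ℕ → (A → ℕ) → List A → ℕ
count k F xs = length (filter (λ a → k ℕ.≟ F a) xs)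

module _ {A : Set} (k : ℕ) where

  count-cong : ∀ {F G : A → ℕ} → F ≗ G → ∀ xs → count k F xs ≡ count k G xs
  count-cong F≗G xs =
    cong length (filter-≐ _ _ ((λ {a} eq → trans eq (F≗G a)) , (λ {a} eq → trans eq (sym (F≗G a)))) xs)

  count-++ : ∀ (F : A → ℕ) xs ys → count k F (xs ++ ys) ≡ count k F xs + count k F ys
  count-++ F xs ys = trans (cong length (filter-++ _ xs ys)) (length-++ (filter _ xs))

  count-map : ∀ {B : Set} (F : B → ℕ) (g : A → B) xs →
              count k F (List.map g xs) ≡ count k (F ∘ g) xs
  count-map F g []       = refl
  count-map F g (a ∷ xs) with k ≡ᵇ F (g a)
  ... | true  = cong suc (count-map F g xs)
  ... | false = count-map F g xs

count-suc : ∀ {A : Set} (F : A → ℕ) xs →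
            (λ k → count k (suc ∘ F) xs) ≈P zMul (λ k → count k F xs)
count-suc F []       zero    = refl
count-suc F []       (suc k) = refl
count-suc F (a ∷ xs) zero    = count-suc F xs zero
count-suc F (a ∷ xs) (suc k) with k ≡ᵇ F a
... | true  = cong suc (count-suc F xs (suc k))
... | false = count-suc F xs (suc k)

zMul-cong : ∀ {p q} → p ≈P q → zMul p ≈P zMul q
zMul-cong p≈q zero    = refl
zMul-cong p≈q (suc k) = p≈q k

module _ (k : ℕ) where

  count-subsets-∷ : ∀ {m} (F : Subset (suc m) → ℕ) →
    count k F (subsets (suc m)) ≡
    count k (F ∘ (false ∷_)) (subsets m) + count k (F ∘ (true ∷_)) (subsets m)
  count-subsets-∷ {m} F = trans (count-++ k F (List.map (false ∷_) (subsets m)) _)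
    (cong₂ _+_ (count-map k F (false ∷_) (subsets m)) (count-map k F (true ∷_) (subsets m)))

  count-subsets-insertAt : ∀ {m} (F : Subset (suc m) → ℕ) x →
    count k F (subsets (suc m)) ≡
    count k (λ A → F (insertAt A x false)) (subsets m)
      + count k (λ A → F (insertAt A x true)) (subsets m)
  count-subsets-insertAt F zero = count-subsets-∷ F
  count-subsets-insertAt {suc m} F (suc x) =
    trans (count-subsets-∷ F)
      (trans (cong₂ _+_ (count-subsets-insertAt (F ∘ (false ∷_)) x)
                        (count-subsets-insertAt (F ∘ (true ∷_)) x))
        (trans (interchange (part false false) (part false true) (part true false) (part true true))
          (sym (cong₂ _+_ (count-subsets-∷ (λ A → F (insertAt A (suc x) false)))
                          (count-subsets-∷ (λ A → F (insertAt A (suc x) true)))))))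
    where
    part : Bool → Bool → ℕ
    part b b′ = count k (λ A → F (b ∷ insertAt A x b′)) (subsets m)

  -- A ↦ E Δ A permutes the subsets.
  count-subsets-Δ : ∀ {m} (E : Subset m) (F : Subset m → ℕ) →
    count k (λ A → F (E Δ A)) (subsets m) ≡ count k F (subsets m)
  count-subsets-Δ []          F = count-cong k (λ { [] → refl }) (subsets 0)
  count-subsets-Δ (false ∷ E) F =
    trans (count-subsets-∷ (λ A → F ((false ∷ E) Δ A)))
      (trans (cong₂ _+_ (count-subsets-Δ E (F ∘ (false ∷_))) (count-subsets-Δ E (F ∘ (true ∷_))))
             (sym (count-subsets-∷ F)))
  count-subsets-Δ (true ∷ E)  F =
    trans (count-subsets-∷ (λ A → F ((true ∷ E) Δ A)))
      (trans (cong₂ _+_ (count-subsets-Δ E (F ∘ (true ∷_))) (count-subsets-Δ E (F ∘ (false ∷_))))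
             (trans (+-comm (count k (F ∘ (true ∷_)) (subsets _)) _) (sym (count-subsets-∷ F))))

adjMatrix-diagonal : ∀ {n} (G : Graft n) L u → adjMatrix G L u u ≡ lookup L u
adjMatrix-diagonal G L u with u ≟ u
... | yes _   = refl
... | no u≢u = contradiction refl u≢u

adjMatrix-off-diagonal : ∀ {n} (G : Graft n) L {u v} → u ≢ v → adjMatrix G L u v ≡ adj G u v
adjMatrix-off-diagonal G L {u} {v} u≢v with u ≟ v
... | yes u≡v = contradiction u≡v u≢v
... | no _    = refl

minor-adjMatrix : ∀ {n} (G : Graft (suc n)) x L b u v →
                  minor (adjMatrix G (insertAt L x b)) x x u v ≡ adjMatrix (deleteVertex G x) L u v
minor-adjMatrix G x L b u v with u ≟ v
... | yes refl = trans (adjMatrix-diagonal G (insertAt L x b) (punchIn x u)) (insertAt-punchIn L x b u)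
... | no u≢v  = adjMatrix-off-diagonal G (insertAt L x b) (u≢v ∘ punchIn-injective x u v)

lookup-⁅⁆ : ∀ {n} (y u : Fin n) → lookup ⁅ y ⁆ u ≡ does (u ≟ y)
lookup-⁅⁆ zero    zero    = refl
lookup-⁅⁆ zero    (suc u) = lookup-replicate u false
lookup-⁅⁆ (suc y) zero    = refl
lookup-⁅⁆ (suc y) (suc u) = lookup-⁅⁆ y u

adjMatrix-toggle-loop : ∀ {n} (G : Graft n) L y u v →
  adjMatrix G L u v xor (does (u ≟ y) ∧ does (v ≟ y)) ≡ adjMatrix G (⁅ y ⁆ Δ L) u v
adjMatrix-toggle-loop G L y u v with u ≟ v
... | yes refl = begin
  lookup L u xor (does (u ≟ y) ∧ does (u ≟ y)) ≡⟨ cong (lookup L u xor_) (∧-idem _) ⟩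
  lookup L u xor does (u ≟ y)                  ≡⟨ xor-comm (lookup L u) _ ⟩
  does (u ≟ y) xor lookup L u                  ≡⟨ cong (_xor lookup L u) (sym (lookup-⁅⁆ y u)) ⟩
  lookup ⁅ y ⁆ u xor lookup L u                ≡⟨ sym (lookup-zipWith _xor_ u ⁅ y ⁆ L) ⟩
  lookup (⁅ y ⁆ Δ L) u                         ∎
  where open ≡-Reasoning
... | no u≢v with u ≟ y | v ≟ y
...   | yes refl | yes refl = contradiction refl u≢v
...   | yes _    | no _     = xor-identityʳ _
...   | no _     | _        = xor-identityʳ _

2≤length-filter : ∀ {A : Set} {P : A → Set} (P? : ∀ a → Dec (P a)) {a b xs} →
                  a ≢ b → a ∈ xs → b ∈ xs → P a → P b → 2 ≤ length (filter P? xs)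
2≤length-filter P? a≢b (here refl)  (here refl)  _  _  = contradiction refl a≢b
2≤length-filter P? a≢b (here refl)  (there b∈)   Pa Pb =
  subst (λ ys → 2 ≤ length ys) (sym (filter-accept P? Pa))
        (s≤s (filter-some P? (Any.map (λ { refl → Pb }) b∈)))
2≤length-filter P? a≢b (there a∈)   (here refl)  Pa Pb =
  subst (λ ys → 2 ≤ length ys) (sym (filter-accept P? Pb))
        (s≤s (filter-some P? (Any.map (λ { refl → Pa }) a∈)))
2≤length-filter P? {xs = c ∷ xs} a≢b (there a∈) (there b∈) Pa Pb with does (P? c)
... | true  = m≤n⇒m≤1+n (2≤length-filter P? a≢b a∈ b∈ Pa Pb)
... | false = 2≤length-filter P? a≢b a∈ b∈ Pa Pb

punchIn-punchIn-comm : ∀ {n} {x y : Fin (suc (suc n))} (x≢y : x ≢ y) (y≢x : y ≢ x) k →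
  punchIn y (punchIn (punchOut y≢x) k) ≡ punchIn x (punchIn (punchOut x≢y) k)
punchIn-punchIn-comm {x = zero}  {zero}  x≢y _ k = contradiction refl x≢y
punchIn-punchIn-comm {x = zero}  {suc y} _   _ k = refl
punchIn-punchIn-comm {x = suc x} {zero}  _   _ k = refl
punchIn-punchIn-comm {zero}  {suc zero} {suc zero} x≢y _ k = contradiction refl x≢y
punchIn-punchIn-comm {suc n} {suc x} {suc y} _ _ zero = refl
punchIn-punchIn-comm {suc n} {suc x} {suc y} x≢y y≢x (suc k) =
  cong suc (punchIn-punchIn-comm (x≢y ∘ cong suc) (y≢x ∘ cong suc) k)

partialTau-via-rank : ∀ {n} (G : Graft n) →
                      partialTau G ≈P (λ k → count k (λ A → rank (adjMatrix G A)) (subsets n))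
partialTau-via-rank G k = count-subsets-Δ k (L G) (λ A → rank (adjMatrix G A))

module Leaf {n} (G : Graft (suc (suc n))) {x y : Fin (suc (suc n))}
            (xy : adj G x y ≡ true) (deg : degree G x ≡ 1) where

  x≢y : x ≢ y
  x≢y = adj⇒≢ G xy

  y≢x : y ≢ x
  y≢x = x≢y ∘ sym

  -- y′ is y in G \ {x}, and x′ is x in G \ {y}.
  y′ x′ : Fin (suc n)
  y′ = punchOut x≢y
  x′ = punchOut y≢x

  P₁ P₂ : Poly
  P₁ = zMul (partialTau (deleteVertex G x))
  P₂ = zMul (zMul (partialTau (deleteTwo G x y x≢y)))

  non-neighbour : ∀ v → v ≢ y → adj G x v ≡ false
  non-neighbour v v≢y with adj G x v in xv
  ... | false = refl
  ... | true  = contradiction (≤-trans (2≤length-filter (λ w → adj G x w Bool.≟ true) v≢y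
                                          (∈-allFin v) (∈-allFin y) xv xy)
                                       (≤-reflexive deg))
                              (λ { (s≤s ()) })

  adj-punchIn : ∀ u → adj G x (punchIn x u) ≡ does (u ≟ y′)
  adj-punchIn u with u ≟ y′
  ... | yes refl = trans (cong (adj G x) (punchIn-punchOut x≢y)) xy
  ... | no u≢y′  = non-neighbour (punchIn x u)
                     (λ eq → u≢y′ (punchIn-injective x u y′ (trans eq (sym (punchIn-punchOut x≢y)))))

  rank-looped : ∀ L → rank (adjMatrix G (insertAt L x true)) ≡
                      suc (rank (adjMatrix (deleteVertex G x) (⁅ y′ ⁆ Δ L)))
  rank-looped L = trans (rank-eliminate M x x Mₓₓ) (cong suc (rank-cong entries))
    where
    L′ = insertAt L x true
    M = adjMatrix G L′
    Mₓₓ : M x x ≡ true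
    Mₓₓ = trans (adjMatrix-diagonal G L′ x) (insertAt-lookup L x true)
    column : ∀ u → M (punchIn x u) x ≡ does (u ≟ y′)
    column u = trans (adjMatrix-off-diagonal G L′ (punchInᵢ≢i x u))
                     (trans (adj-sym G _ x) (adj-punchIn u))
    row : ∀ j → M x (punchIn x j) ≡ does (j ≟ y′)
    row j = trans (adjMatrix-off-diagonal G L′ (punchInᵢ≢i x j ∘ sym)) (adj-punchIn j)
    entries : ∀ u j → eliminate M x x u j ≡ adjMatrix (deleteVertex G x) (⁅ y′ ⁆ Δ L) u j
    entries u j = trans (cong₂ _xor_ (minor-adjMatrix G x L true u j) (cong₂ _∧_ (column u) (row j)))
                        (adjMatrix-toggle-loop (deleteVertex G x) L y′ u j)

  -- Row x is the unit vector at y, and in the minor at (x, y) column x is the unit vector at y′.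
  rank-loopless : ∀ b L → rank (adjMatrix G (insertAt (insertAt L y′ b) x false)) ≡
                          2 + rank (adjMatrix (deleteTwo G x y x≢y) L)
  rank-loopless b L =
    trans (rank-minor-row M x y Mₓᵧ row)
          (cong suc (trans (rank-minor-column (minor M x y) y′ x′ Mᵧₓ column)
                           (cong suc (rank-cong entries))))
    where
    L′ = insertAt (insertAt L y′ b) x false
    M = adjMatrix G L′
    Mₓᵧ : M x y ≡ true
    Mₓᵧ = trans (adjMatrix-off-diagonal G L′ x≢y) xy
    row : ∀ j → M x (punchIn y j) ≡ false
    row j with punchIn y j ≟ x
    ... | yes refl = trans (adjMatrix-diagonal G L′ x) (insertAt-lookup _ x false)
    ... | no v≢x   = trans (adjMatrix-off-diagonal G L′ (v≢x ∘ sym))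
                           (non-neighbour _ (punchInᵢ≢i y j))
    Mᵧₓ : minor M x y y′ x′ ≡ true
    Mᵧₓ = trans (cong₂ M (punchIn-punchOut x≢y) (punchIn-punchOut y≢x))
                (trans (adjMatrix-off-diagonal G L′ y≢x) (trans (adj-sym G y x) xy))
    column : ∀ u → minor M x y (punchIn y′ u) x′ ≡ false
    column u = trans (cong (M (punchIn x (punchIn y′ u))) (punchIn-punchOut y≢x))
                 (trans (adjMatrix-off-diagonal G L′ (punchInᵢ≢i x _))
                   (trans (adj-sym G _ x)
                     (trans (adj-punchIn (punchIn y′ u))
                            (dec-false (punchIn y′ u ≟ y′) (punchInᵢ≢i y′ u)))))
    entries : ∀ u j → minor (minor M x y) y′ x′ u j ≡ adjMatrix (deleteTwo G x y x≢y) L u j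
    entries u j = begin
      M (punchIn x (punchIn y′ u)) (punchIn y (punchIn x′ j))
        ≡⟨ cong (M (punchIn x (punchIn y′ u))) (punchIn-punchIn-comm x≢y y≢x j) ⟩
      minor (minor M x x) y′ y′ u j
        ≡⟨ minor-adjMatrix G x (insertAt L y′ b) false _ _ ⟩
      minor (adjMatrix (deleteVertex G x) (insertAt L y′ b)) y′ y′ u j
        ≡⟨ minor-adjMatrix (deleteVertex G x) y′ L b u j ⟩
      adjMatrix (deleteTwo G x y x≢y) L u j ∎
      where open ≡-Reasoning

  count-looped : (λ k → count k (λ A → rank (adjMatrix G (insertAt A x true))) (subsets (suc n))) ≈P P₁
  count-looped k =
    trans (count-cong k rank-looped (subsets (suc n)))
      (trans (count-suc (λ A → R₁ (⁅ y′ ⁆ Δ A)) (subsets (suc n)) k)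
        (zMul-cong (λ k′ → trans (count-subsets-Δ k′ ⁅ y′ ⁆ R₁)
                                 (sym (partialTau-via-rank (deleteVertex G x) k′))) k))
    where
    R₁ : Subset (suc n) → ℕ
    R₁ A = rank (adjMatrix (deleteVertex G x) A)

  count-loopless : (λ k → count k (λ A → rank (adjMatrix G (insertAt A x false))) (subsets (suc n)))
                   ≈P (λ k → P₂ k + P₂ k)
  count-loopless k =
    trans (count-subsets-insertAt k _ y′) (cong₂ _+_ (via-rank-loopless false) (via-rank-loopless true))
    where
    R₂ : Subset n → ℕ
    R₂ A = rank (adjMatrix (deleteTwo G x y x≢y) A)
    via-rank-loopless : ∀ b →
      count k (λ A → rank (adjMatrix G (insertAt (insertAt A y′ b) x false))) (subsets n) ≡ P₂ k
    via-rank-loopless b =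
      trans (count-cong k (rank-loopless b) (subsets n))
        (trans (count-suc (suc ∘ R₂) (subsets n) k)
          (zMul-cong (λ k′ → trans (count-suc R₂ (subsets n) k′)
                                   (zMul-cong (sym ∘ partialTau-via-rank (deleteTwo G x y x≢y)) k′)) k))

proposition3p6 : (n : ℕ) (G : Graft (suc (suc n))) (x y : Fin (suc (suc n)))
    → (xy : adj G x y ≡ true) → degree G x ≡ 1
    → partialTau G ≈P
        (zMul (partialTau (deleteVertex G x))
         ⊕ scale 2 (zMul (zMul (partialTau (deleteTwo G x y (adj⇒≢ G xy))))))
proposition3p6 n G x y xy deg k = begin
  partialTau G k
    ≡⟨ partialTau-via-rank G k ⟩
  count k R (subsets (suc (suc n)))
    ≡⟨ count-subsets-insertAt k R x ⟩
  count k (λ A → R (insertAt A x false)) (subsets (suc n))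
    + count k (λ A → R (insertAt A x true)) (subsets (suc n))
    ≡⟨ cong₂ _+_ (count-loopless k) (count-looped k) ⟩
  (P₂ k + P₂ k) + P₁ k
    ≡⟨ +-comm (P₂ k + P₂ k) (P₁ k) ⟩
  P₁ k + (P₂ k + P₂ k)
    ≡⟨ cong (λ m → P₁ k + (P₂ k + m)) (sym (+-identityʳ (P₂ k))) ⟩
  P₁ k + 2 * P₂ k ∎
  where
  open Leaf G xy deg
  open ≡-Reasoning
  R : Subset (suc (suc n)) → ℕ
  R A = rank (adjMatrix G A)
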